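{- Let $G$ be a finite simple graph with vertex set $\{1,\dots,n\}$ and let $t\ge2$ be an integer. If $x\in\Delta^{n-1}$ is a minimizer of $\Phi(G,\cdot)$ over $\Delta^{n-1}$ with minimal support (i.e. there is no minimizer $x'$ with $\operatorname{Supp}(x')\subsetneq\operatorname{Supp}(x)$), then the induced subgraph $G[\operatorname{Supp}(x)]$ is a clique.
   Context: $\Delta^{n-1}=\{x\in\mathbb{R}^n: x_i\ge0,\ \sum_i x_i=1\}$, $\operatorname{Supp}(x)=\{v: x_v\ne0\}$. $c(v)$ is the order of the largest clique of $G$ containing $v$, and \[ \Phi(G,x)=\sum_{v\in V(G)}\frac{x_v}{c(v)^t}\binom{c(v)}{t}-\sum_{K_t\subseteq G}\prod_{v\in V(K_t)}x_v, \] the second sum over all copies of $K_t$ in $G$. -}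

module Defs where

open import Level using (0ℓ)
open import Data.Bool using (Bool; true; false; _∧_; _∨_; not; if_then_else_; T)
open import Data.Nat as ℕ using (ℕ; zero; suc; _⊔_)
open import Data.Nat.Combinatorics using (_C_)
open import Data.Fin using (Fin; zero; suc; _≟_)
open import Data.Fin.Subset using (Subset; ∣_∣)
open import Data.Vec using (Vec; []; _∷_; lookup)
open import Data.List using (List; []; _∷_; _++_; map; foldr; filter; allFin)
open import Data.Product using (Σ; ∃; _×_; _,_)
open import Data.Sum using (_⊎_)
open import Relation.Nullary using (¬_; does)
open import Relation.Binary.PropositionalEquality using (_≡_; _≢_)

-- Every complete ordered field is isomorphic to ℝ, so quantifying over
-- all such structures is the same as speaking about ℝ.

record RealField : Set₁ where
  infixl 6 _+_
  infixl 7 _*_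
  infix  4 _≤_
  field
    Carrier : Set
    0# 1#   : Carrier
    _+_ _*_ : Carrier → Carrier → Carrier
    -_      : Carrier → Carrier
    _⁻¹     : Carrier → Carrier     -- total inverse, 0 ⁻¹ arbitrary
    _≤_     : Carrier → Carrier → Set
    +-assoc   : ∀ a b c → (a + b) + c ≡ a + (b + c)
    +-comm    : ∀ a b → a + b ≡ b + a
    +-identity : ∀ a → 0# + a ≡ a
    +-inverse : ∀ a → a + (- a) ≡ 0#
    *-assoc   : ∀ a b c → (a * b) * c ≡ a * (b * c)
    *-comm    : ∀ a b → a * b ≡ b * a
    *-identity : ∀ a → 1# * a ≡ a
    distrib   : ∀ a b c → a * (b + c) ≡ a * b + a * c
    0≢1       : 0# ≢ 1#
    *-inverse : ∀ a → a ≢ 0# → a * (a ⁻¹) ≡ 1#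
    ≤-refl    : ∀ a → a ≤ a
    ≤-trans   : ∀ {a b c} → a ≤ b → b ≤ c → a ≤ c
    ≤-antisym : ∀ {a b} → a ≤ b → b ≤ a → a ≡ b
    ≤-total   : ∀ a b → a ≤ b ⊎ b ≤ a
    +-mono-≤  : ∀ {a b} c → a ≤ b → a + c ≤ b + c
    *-nonneg  : ∀ {a b} → 0# ≤ a → 0# ≤ b → 0# ≤ a * b
    sup : (P : Carrier → Set) → Σ Carrier P →
          Σ Carrier (λ b → ∀ y → P y → y ≤ b) →
          Σ Carrier (λ s → (∀ y → P y → y ≤ s) ×
                           (∀ b → (∀ y → P y → y ≤ b) → s ≤ b))

-- Finite simple graphs on vertex set Fin n (≅ {1,…,n}).

record SimpleGraph (n : ℕ) : Set where
  field
    Adj     : Fin n → Fin n → Bool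
    symm    : ∀ u v → Adj u v ≡ Adj v u
    irrefl  : ∀ v → Adj v v ≡ false

open SimpleGraph public

allSubsets : (n : ℕ) → List (Subset n)
allSubsets zero    = [] ∷ []
allSubsets (suc n) = map (true ∷_) (allSubsets n) ++ map (false ∷_) (allSubsets n)

allB : ∀ {A : Set} → (A → Bool) → List A → Bool
allB p = foldr (λ a b → p a ∧ b) true

isClique : ∀ {n} → SimpleGraph n → Subset n → Bool
isClique {n} G S =
  allB (λ u → allB (λ v →
      not (lookup S u ∧ lookup S v) ∨ does (u ≟ v) ∨ Adj G u v)
    (allFin n)) (allFin n)

maxℕ : List ℕ → ℕ
maxℕ = foldr _⊔_ 0

cliqueNum : ∀ {n} → SimpleGraph n → Fin n → ℕ
cliqueNum {n} G v =
  maxℕ (map ∣_∣ (filter (λ S → T? (isClique G S ∧ lookup S v)) (allSubsets n)))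
  where
  open import Data.Bool.Properties using (T?)

copiesK : ∀ {n} → SimpleGraph n → ℕ → List (Subset n)
copiesK {n} G t =
  filter (λ S → T? (isClique G S ∧ does (∣ S ∣ ℕ.≟ t))) (allSubsets n)
  where
  open import Data.Bool.Properties using (T?)

module _ (R : RealField) where
  open RealField R

  sumR : List Carrier → Carrier
  sumR = foldr _+_ 0#

  prodR : List Carrier → Carrier
  prodR = foldr _*_ 1#

  fromℕ : ℕ → Carrier
  fromℕ zero    = 0#
  fromℕ (suc k) = 1# + fromℕ k

  powR : Carrier → ℕ → Carrier
  powR a zero    = 1#
  powR a (suc k) = a * powR a k

  InSimplex : ∀ {n} → (Fin n → Carrier) → Set
  InSimplex {n} x = (∀ i → 0# ≤ x i) × sumR (map x (allFin n)) ≡ 1#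

  Φ : ∀ {n} → SimpleGraph n → ℕ → (Fin n → Carrier) → Carrier
  Φ {n} G t x =
    sumR (map (λ v → x v * (powR (fromℕ (cliqueNum G v)) t) ⁻¹
                         * fromℕ (cliqueNum G v C t)) (allFin n))
    + - sumR (map (λ S → prodR (map x (filter (λ v → T? (lookup S v)) (allFin n))))
                  (copiesK G t))
    where
    open import Data.Bool.Properties using (T?)

  IsMinimizer : ∀ {n} → SimpleGraph n → ℕ → (Fin n → Carrier) → Set
  IsMinimizer G t x = InSimplex x × (∀ y → InSimplex y → Φ G t x ≤ Φ G t y)

  InSupp : ∀ {n} → (Fin n → Carrier) → Fin n → Set
  InSupp x v = x v ≢ 0#

  SuppStrictSub : ∀ {n} → (Fin n → Carrier) → (Fin n → Carrier) → Set
  SuppStrictSub x' x = (∀ v → InSupp x' v → InSupp x v) × ∃ (λ v → InSupp x v × x' v ≡ 0#)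

  IsMinSuppMinimizer : ∀ {n} → SimpleGraph n → ℕ → (Fin n → Carrier) → Set
  IsMinSuppMinimizer G t x =
    IsMinimizer G t x × (¬ ∃ (λ x' → IsMinimizer G t x' × SuppStrictSub x' x))

  SuppIsClique : ∀ {n} → SimpleGraph n → (Fin n → Carrier) → Set
  SuppIsClique G x = ∀ u v → u ≢ v → InSupp x u → InSupp x v → Adj G u v ≡ true

{-# OPTIONS --safe #-}
-- Suppose u ≠ v lie in Supp(x) but are not adjacent.  No copy of K_t contains both, so each
-- monomial of Φ contains at most one of x_u, x_v, and Φ is affine along the direction e_v − e_u.
-- The segment x + s (e_v − e_u), −x_v ≤ s ≤ x_u, lies in the simplex and an affine function
-- attains its minimum over it at an endpoint; that endpoint is therefore again a minimiser, and
-- its support is Supp(x) with u or v removed, contradicting minimality of the support.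
module Submission where

open import Defs
open import Level using (0ℓ)
open import Data.Nat as ℕ using (ℕ; _≤_)
open import Data.Fin using (Fin; _≟_)
open import Data.Fin.Subset using (Subset; ∣_∣)
open import Data.Bool using (Bool; true; false; T; _∧_; if_then_else_)
open import Data.Bool.Properties using (T?; T-∧)
open import Data.Vec using (lookup)
open import Data.List using (List; []; _∷_; map; filter; allFin)
open import Data.List.Properties using (map-cong)
open import Data.List.Relation.Unary.All as All using (All; []; _∷_)
open import Data.List.Relation.Unary.Any using (here; there)
open import Data.List.Relation.Unary.AllPairs using ([]; _∷_)
open import Data.List.Relation.Unary.Unique.Propositional using (Unique)
open import Data.List.Relation.Unary.Unique.Propositional.Properties using (allFin⁺; filter⁺)
open import Data.List.Membership.Propositional using (_∈_)
open import Data.List.Membership.Propositional.Properties using (∈-filter⁻; ∈-allFin)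
open import Data.Product using (Σ; ∃; _×_; _,_; proj₁; proj₂)
open import Data.Sum as Sum using (_⊎_; inj₁; inj₂)
open import Function using (Equivalence)
open import Data.Empty using (⊥-elim)
open import Relation.Nullary using (yes; no; does)
open import Relation.Nullary.Decidable using (dec-true; dec-false)
open import Relation.Binary.PropositionalEquality
open import Algebra using (CommutativeRing)
import Algebra.Properties.Ring as RingProperties
import Algebra.Properties.CommutativeSemigroup as CommutativeSemigroupProperties

T-allB : ∀ {A : Set} (p : A → Bool) {L} → T (allB p L) → ∀ {a} → a ∈ L → T (p a)
T-allB p {a ∷ L} all (here refl) = proj₁ (Equivalence.to T-∧ all)
T-allB p {a ∷ L} all (there a∈L) = T-allB p (proj₂ (Equivalence.to T-∧ all)) a∈L

module _ {n} (G : SimpleGraph n) where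

  clique-adjacent : ∀ S {u v} → T (isClique G S) → lookup S u ≡ true → lookup S v ≡ true →
                    u ≢ v → T (Adj G u v)
  clique-adjacent S {u} {v} clique Su Sv u≢v
    with T-allB _ (T-allB _ clique (∈-allFin u)) (∈-allFin v)
  ... | adjacent rewrite Su | Sv | dec-false (u ≟ v) u≢v = adjacent

  clique-misses-non-edge : ∀ S {u v} → Adj G u v ≡ false → u ≢ v → T (isClique G S) →
                           lookup S u ≡ false ⊎ lookup S v ≡ false
  clique-misses-non-edge S {u} {v} non-edge u≢v clique with lookup S u in Su | lookup S v in Sv
  ... | false | _     = inj₁ refl
  ... | true  | false = inj₂ refl
  ... | true  | true  = ⊥-elim (subst T non-edge (clique-adjacent S clique Su Sv u≢v))

  copiesK-clique : ∀ {t S} → S ∈ copiesK G t → T (isClique G S)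
  copiesK-clique {t} {S} S∈K =
    proj₁ (Equivalence.to T-∧ (proj₂ (∈-filter⁻ (λ S → T? (isClique G S ∧ does (∣ S ∣ ℕ.≟ t)))
                                                {xs = allSubsets n} S∈K)))

vertices : ∀ {n} → Subset n → List (Fin n)
vertices {n} S = filter (λ w → T? (lookup S w)) (allFin n)

vertices-unique : ∀ {n} (S : Subset n) → Unique (vertices S)
vertices-unique {n} S = filter⁺ (λ w → T? (lookup S w)) (allFin⁺ n)

vertices-avoid : ∀ {n} (S : Subset n) {a} → lookup S a ≡ false → All (a ≢_) (vertices S)
vertices-avoid {n} S Sa≡false = All.tabulate λ w∈S a≡w →
  subst T (trans (cong (lookup S) (sym a≡w)) Sa≡false)
        (proj₂ (∈-filter⁻ (λ w → T? (lookup S w)) {xs = allFin n} w∈S))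

≡-or-≡-or-≢ : ∀ {n} (u v w : Fin n) → w ≡ u ⊎ w ≡ v ⊎ (w ≢ u × w ≢ v)
≡-or-≡-or-≢ u v w with w ≟ u | w ≟ v
... | yes w≡u | _       = inj₁ w≡u
... | no _    | yes w≡v = inj₂ (inj₁ w≡v)
... | no w≢u  | no w≢v  = inj₂ (inj₂ (w≢u , w≢v))

module RealFieldProperties (R : RealField) where
  open RealField R renaming (_≤_ to _≤ᵣ_)

  +-identityʳ : ∀ a → a + 0# ≡ a
  +-identityʳ a = trans (+-comm a 0#) (+-identity a)

  *-identityʳ : ∀ a → a * 1# ≡ a
  *-identityʳ a = trans (*-comm a 1#) (*-identity a)

  commutativeRing : CommutativeRing 0ℓ 0ℓ
  commutativeRing = record { isCommutativeRing = record
    { isRing = record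
      { +-isAbelianGroup = record
        { isGroup = record
          { isMonoid = record
            { isSemigroup = record
              { isMagma = record { isEquivalence = isEquivalence ; ∙-cong = cong₂ _+_ }
              ; assoc = +-assoc }
            ; identity = +-identity , +-identityʳ }
          ; inverse = (λ a → trans (+-comm (- a) a) (+-inverse a)) , +-inverse
          ; ⁻¹-cong = cong -_ }
        ; comm = +-comm }
      ; *-cong = cong₂ _*_
      ; *-assoc = *-assoc
      ; *-identity = *-identity , *-identityʳ
      ; distrib = distrib , λ a b c → trans (*-comm (b + c) a)
                    (trans (distrib a b c) (cong₂ _+_ (*-comm a b) (*-comm a c))) }
    ; *-comm = *-comm } }

  open CommutativeRing commutativeRing public using (zeroˡ; zeroʳ; distribʳ)
  open RingProperties (CommutativeRing.ring commutativeRing) public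
    using (-‿distribʳ-*; -‿involutive; -‿+-comm)
  open CommutativeSemigroupProperties (CommutativeRing.+-commutativeSemigroup commutativeRing) public
    using () renaming (interchange to +-interchange)
  open CommutativeSemigroupProperties (CommutativeRing.*-commutativeSemigroup commutativeRing) public
    using () renaming (x∙yz≈y∙xz to *-leftComm)

  0≤x⇒-x≤0 : ∀ {a} → 0# ≤ᵣ a → - a ≤ᵣ 0#
  0≤x⇒-x≤0 {a} 0≤a = subst₂ _≤ᵣ_ (+-identity (- a)) (+-inverse a) (+-mono-≤ (- a) 0≤a)

  x≤0⇒0≤-x : ∀ {a} → a ≤ᵣ 0# → 0# ≤ᵣ - a
  x≤0⇒0≤-x {a} a≤0 = subst₂ _≤ᵣ_ (+-inverse a) (+-identity (- a)) (+-mono-≤ (- a) a≤0)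

  0≤x⇒0≤y⇒0≤x+y : ∀ {a b} → 0# ≤ᵣ a → 0# ≤ᵣ b → 0# ≤ᵣ a + b
  0≤x⇒0≤y⇒0≤x+y {a} {b} 0≤a 0≤b =
    ≤-trans 0≤b (subst (_≤ᵣ a + b) (+-identity b) (+-mono-≤ b 0≤a))

  0≤x⇒y≤0⇒x*y≤0 : ∀ {a b} → 0# ≤ᵣ a → b ≤ᵣ 0# → a * b ≤ᵣ 0#
  0≤x⇒y≤0⇒x*y≤0 {a} {b} 0≤a b≤0 =
    subst (_≤ᵣ 0#) ab≡ (0≤x⇒-x≤0 (*-nonneg 0≤a (x≤0⇒0≤-x b≤0)))
    where
    ab≡ : - (a * - b) ≡ a * b
    ab≡ = trans (cong -_ (sym (-‿distribʳ-* a b))) (-‿involutive (a * b))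

  y≤0⇒x+y≤x : ∀ a {c} → c ≤ᵣ 0# → a + c ≤ᵣ a
  y≤0⇒x+y≤x a {c} c≤0 = subst₂ _≤ᵣ_ (+-comm c a) (+-identity a) (+-mono-≤ a c≤0)

  a+sb+[c+sd]≡a+c+s[b+d] : ∀ a b c d s → (a + s * b) + (c + s * d) ≡ (a + c) + s * (b + d)
  a+sb+[c+sd]≡a+c+s[b+d] a b c d s =
    trans (+-interchange a (s * b) c (s * d)) (cong ((a + c) +_) (sym (distrib s b d)))

module _ (R : RealField) where
  open RealField R renaming (_≤_ to _≤ᵣ_)
  open RealFieldProperties R

  Affine : (Carrier → Carrier) → Set
  Affine f = Σ Carrier λ P → Σ Carrier λ Q → ∀ s → f s ≡ P + s * Q

  affine-const : ∀ c → Affine (λ _ → c)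
  affine-const c = c , 0# , λ s → sym (trans (cong (c +_) (zeroʳ s)) (+-identityʳ c))

  module _ {f g : Carrier → Carrier} where

    affine-cong : (∀ s → f s ≡ g s) → Affine f → Affine g
    affine-cong f≗g (P , Q , f≡) = P , Q , λ s → trans (sym (f≗g s)) (f≡ s)

    affine-+ : Affine f → Affine g → Affine (λ s → f s + g s)
    affine-+ (P , Q , f≡) (P′ , Q′ , g≡) = P + P′ , Q + Q′ , λ s →
      trans (cong₂ _+_ (f≡ s) (g≡ s)) (a+sb+[c+sd]≡a+c+s[b+d] P Q P′ Q′ s)

  module _ {f : Carrier → Carrier} where

    affine-neg : Affine f → Affine (λ s → - f s)
    affine-neg (P , Q , f≡) = - P , - Q , λ s → begin
      - f s             ≡⟨ cong -_ (f≡ s) ⟩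
      - (P + s * Q)     ≡⟨ sym (-‿+-comm P (s * Q)) ⟩
      - P + - (s * Q)   ≡⟨ cong (- P +_) (-‿distribʳ-* s Q) ⟩
      - P + s * - Q     ∎
      where open ≡-Reasoning

    affine-*ˡ : ∀ c → Affine f → Affine (λ s → c * f s)
    affine-*ˡ c (P , Q , f≡) = c * P , c * Q , λ s → begin
      c * f s                ≡⟨ cong (c *_) (f≡ s) ⟩
      c * (P + s * Q)        ≡⟨ distrib c P (s * Q) ⟩
      c * P + c * (s * Q)    ≡⟨ cong (c * P +_) (*-leftComm c s Q) ⟩
      c * P + s * (c * Q)    ∎
      where open ≡-Reasoning

    affine-*ʳ : Affine f → ∀ c → Affine (λ s → f s * c)
    affine-*ʳ (P , Q , f≡) c = P * c , Q * c , λ s → begin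
      f s * c                ≡⟨ cong (_* c) (f≡ s) ⟩
      (P + s * Q) * c        ≡⟨ distribʳ c P (s * Q) ⟩
      P * c + s * Q * c      ≡⟨ cong (P * c +_) (*-assoc s Q c) ⟩
      P * c + s * (Q * c)    ∎
      where open ≡-Reasoning

    affine-≤-endpoint : Affine f → ∀ {a b} → a ≤ᵣ 0# → 0# ≤ᵣ b → f b ≤ᵣ f 0# ⊎ f a ≤ᵣ f 0#
    affine-≤-endpoint (P , Q , f≡) {a} {b} a≤0 0≤b =
      Sum.map (λ Q≤0 → below b (0≤x⇒y≤0⇒x*y≤0 0≤b Q≤0))
              (λ 0≤Q → below a (subst (_≤ᵣ 0#) (*-comm Q a) (0≤x⇒y≤0⇒x*y≤0 0≤Q a≤0)))
              (≤-total Q 0#)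
      where
      below : ∀ s → s * Q ≤ᵣ 0# → f s ≤ᵣ f 0#
      below s sQ≤0 = subst₂ _≤ᵣ_ (sym (f≡ s)) f0≡P (y≤0⇒x+y≤x P sQ≤0)
        where
        f0≡P : P ≡ f 0#
        f0≡P = sym (trans (f≡ 0#) (trans (cong (P +_) (zeroˡ Q)) (+-identityʳ P)))

  affine-sum : ∀ {A : Set} (f : Carrier → A → Carrier) (L : List A) →
               All (λ a → Affine (λ s → f s a)) L → Affine (λ s → sumR R (map (f s) L))
  affine-sum f []      []         = affine-const 0#
  affine-sum f (a ∷ L) (fa ∷ fL) = affine-+ fa (affine-sum f L fL)

  module _ {n} {d : Fin n → Carrier} where

    fixed-or-≡ : ∀ {u v} → (∀ w → w ≢ u → w ≢ v → d w ≡ 0#) →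
                 ∀ {L} → All (u ≢_) L → All (λ w → d w ≡ 0# ⊎ w ≡ v) L
    fixed-or-≡ {u} {v} d-supp = All.map fixed-or-target
      where
      fixed-or-target : ∀ {w} → u ≢ w → d w ≡ 0# ⊎ w ≡ v
      fixed-or-target {w} u≢w with w ≟ v
      ... | yes w≡v = inj₂ w≡v
      ... | no  w≢v = inj₁ (d-supp w (λ w≡u → u≢w (sym w≡u)) w≢v)

    fixed-if-≢ : ∀ {b L} → All (λ w → d w ≡ 0# ⊎ w ≡ b) L → All (b ≢_) L →
                 All (λ w → d w ≡ 0#) L
    fixed-if-≢ []                   []          = []
    fixed-if-≢ (inj₁ dw≡0 ∷ fixed) (_ ∷ b∉L)   = dw≡0 ∷ fixed-if-≢ fixed b∉L
    fixed-if-≢ (inj₂ refl ∷ _)      (b≢b ∷ _)   = ⊥-elim (b≢b refl)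

    sum-fixed : ∀ {L} → All (λ w → d w ≡ 0#) L → sumR R (map d L) ≡ 0#
    sum-fixed []             = refl
    sum-fixed (dw≡0 ∷ fixed) = trans (cong₂ _+_ dw≡0 (sum-fixed fixed)) (+-identity 0#)

    sum-single : ∀ {b L} → Unique L → b ∈ L → All (λ w → d w ≡ 0# ⊎ w ≡ b) L →
                 sumR R (map d L) ≡ d b
    sum-single {b} (b∉L ∷ _) (here refl) (_ ∷ fixed) =
      trans (cong (d b +_) (sum-fixed (fixed-if-≢ fixed b∉L))) (+-identityʳ (d b))
    sum-single {b} (_ ∷ uniq) (there b∈L) (inj₁ dw≡0 ∷ fixed) =
      trans (cong₂ _+_ dw≡0 (sum-single uniq b∈L fixed)) (+-identity (d b))
    sum-single (w∉L ∷ _) (there w∈L) (inj₂ refl ∷ _) = ⊥-elim (All.lookup w∉L w∈L refl)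

  shift : ∀ {n} → (Fin n → Carrier) → (Fin n → Carrier) → Carrier → Fin n → Carrier
  shift x d s w = x w + s * d w

  affine-shift : ∀ {n} (x d : Fin n → Carrier) w → Affine (λ s → shift x d s w)
  affine-shift x d w = x w , d w , λ _ → refl

  module _ {n} {x d : Fin n → Carrier} where

    shift-zero : ∀ w → shift x d 0# w ≡ x w
    shift-zero w = trans (cong (x w +_) (zeroˡ (d w))) (+-identityʳ (x w))

    shift-fixed : ∀ {w} → d w ≡ 0# → ∀ s → shift x d s w ≡ x w
    shift-fixed {w} dw≡0 s =
      trans (cong (λ c → x w + s * c) dw≡0) (trans (cong (x w +_) (zeroʳ s)) (+-identityʳ (x w)))

    sum-shift : ∀ L s → sumR R (map (shift x d s) L) ≡ sumR R (map x L) + s * sumR R (map d L)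
    sum-shift []      s = sym (trans (cong (0# +_) (zeroʳ s)) (+-identityʳ 0#))
    sum-shift (w ∷ L) s = trans (cong (shift x d s w +_) (sum-shift L s))
                                (a+sb+[c+sd]≡a+c+s[b+d] (x w) (d w) _ _ s)

    prod-fixed : ∀ {L} → All (λ w → d w ≡ 0#) L →
                 ∀ s → prodR R (map (shift x d s) L) ≡ prodR R (map x L)
    prod-fixed []             s = refl
    prod-fixed (dw≡0 ∷ fixed) s = cong₂ _*_ (shift-fixed dw≡0 s) (prod-fixed fixed s)

    affine-prod : ∀ {b} L → Unique L → All (λ w → d w ≡ 0# ⊎ w ≡ b) L →
                  Affine (λ s → prodR R (map (shift x d s) L))
    affine-prod [] [] [] = affine-const 1#
    affine-prod (w ∷ L) (_ ∷ uniq) (inj₁ dw≡0 ∷ fixed) =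
      affine-cong (λ s → cong (_* prodR R (map (shift x d s) L)) (sym (shift-fixed dw≡0 s)))
                  (affine-*ˡ (x w) (affine-prod L uniq fixed))
    affine-prod (w ∷ L) (w∉L ∷ _) (inj₂ refl ∷ fixed) =
      affine-cong (λ s → cong (shift x d s w *_) (sym (prod-fixed (fixed-if-≢ fixed w∉L) s)))
                  (affine-*ʳ (affine-shift x d w) (prodR R (map x L)))

  transfer : ∀ {n} → Fin n → Fin n → Fin n → Carrier
  transfer u v w = if does (w ≟ u) then - 1# else if does (w ≟ v) then 1# else 0#

  module _ {n} (u v : Fin n) where

    transfer-source : transfer u v u ≡ - 1#
    transfer-source rewrite dec-true (u ≟ u) refl = refl

    transfer-target : u ≢ v → transfer u v v ≡ 1#
    transfer-target u≢v
      rewrite dec-false (v ≟ u) (λ v≡u → u≢v (sym v≡u)) | dec-true (v ≟ v) refl = refl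

    transfer-elsewhere : ∀ w → w ≢ u → w ≢ v → transfer u v w ≡ 0#
    transfer-elsewhere w w≢u w≢v rewrite dec-false (w ≟ u) w≢u | dec-false (w ≟ v) w≢v = refl

    sum-transfer : u ≢ v → ∀ {L} → Unique L → u ∈ L → v ∈ L →
                   sumR R (map (transfer u v) L) ≡ 0#
    sum-transfer u≢v (_ ∷ _) (here refl) (here v≡u) = ⊥-elim (u≢v (sym v≡u))
    sum-transfer u≢v {_ ∷ L} (u∉L ∷ uniq) (here refl) (there v∈L) = begin
      transfer u v u + sumR R (map (transfer u v) L)  ≡⟨ cong₂ _+_ transfer-source target-sum ⟩
      - 1# + 1#                                         ≡⟨ +-comm (- 1#) 1# ⟩
      1# + - 1#                                         ≡⟨ +-inverse 1# ⟩
      0#                                                ∎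
      where
      open ≡-Reasoning
      target-sum : sumR R (map (transfer u v) L) ≡ 1#
      target-sum = trans (sum-single uniq v∈L (fixed-or-≡ transfer-elsewhere u∉L))
                         (transfer-target u≢v)
    sum-transfer u≢v {_ ∷ L} (v∉L ∷ uniq) (there u∈L) (here refl) = begin
      transfer u v v + sumR R (map (transfer u v) L)  ≡⟨ cong₂ _+_ (transfer-target u≢v) source-sum ⟩
      1# + - 1#                                         ≡⟨ +-inverse 1# ⟩
      0#                                                ∎
      where
      open ≡-Reasoning
      source-sum : sumR R (map (transfer u v) L) ≡ - 1#
      source-sum = trans (sum-single uniq u∈L (fixed-or-≡ {d = transfer u v} elsewhere v∉L))
                         transfer-source
        where
        elsewhere : ∀ w → w ≢ v → w ≢ u → transfer u v w ≡ 0#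
        elsewhere w w≢v w≢u = transfer-elsewhere w w≢u w≢v
    sum-transfer u≢v (w∉L ∷ uniq) (there u∈L) (there v∈L) =
      trans (cong₂ _+_ (transfer-elsewhere _ (All.lookup w∉L u∈L) (All.lookup w∉L v∈L))
                       (sum-transfer u≢v uniq u∈L v∈L))
            (+-identity 0#)

  module _ {n} (x : Fin n → Carrier) {u v : Fin n} (u≢v : u ≢ v) where

    shift-transfer-source : ∀ s → shift x (transfer u v) s u ≡ x u + - s
    shift-transfer-source s = cong (x u +_) (begin
      s * transfer u v u  ≡⟨ cong (s *_) (transfer-source u v) ⟩
      s * - 1#            ≡⟨ sym (-‿distribʳ-* s 1#) ⟩
      - (s * 1#)          ≡⟨ cong -_ (*-identityʳ s) ⟩
      - s                 ∎)
      where open ≡-Reasoning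

    shift-transfer-target : ∀ s → shift x (transfer u v) s v ≡ x v + s
    shift-transfer-target s =
      cong (x v +_) (trans (cong (s *_) (transfer-target u v u≢v)) (*-identityʳ s))

    shift-transfer-elsewhere : ∀ s w → w ≢ u → w ≢ v → shift x (transfer u v) s w ≡ x w
    shift-transfer-elsewhere s w w≢u w≢v =
      shift-fixed {x = x} {d = transfer u v} (transfer-elsewhere u v w w≢u w≢v) s

    shift-transfer-InSimplex : InSimplex R x → ∀ s →
      0# ≤ᵣ shift x (transfer u v) s u → 0# ≤ᵣ shift x (transfer u v) s v →
      InSimplex R (shift x (transfer u v) s)
    shift-transfer-InSimplex (x≥0 , Σx≡1) s 0≤u 0≤v = nonneg , (begin
      sumR R (map (shift x (transfer u v) s) (allFin n))  ≡⟨ sum-shift (allFin n) s ⟩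
      sumR R (map x (allFin n)) + s * sumR R (map (transfer u v) (allFin n))
        ≡⟨ cong (λ c → sumR R (map x (allFin n)) + s * c)
                (sum-transfer u v u≢v (allFin⁺ n) (∈-allFin u) (∈-allFin v)) ⟩
      sumR R (map x (allFin n)) + s * 0#  ≡⟨ cong (_ +_) (zeroʳ s) ⟩
      sumR R (map x (allFin n)) + 0#      ≡⟨ +-identityʳ _ ⟩
      sumR R (map x (allFin n))           ≡⟨ Σx≡1 ⟩
      1#                                  ∎)
      where
      open ≡-Reasoning
      nonneg : ∀ w → 0# ≤ᵣ shift x (transfer u v) s w
      nonneg w with ≡-or-≡-or-≢ u v w
      ... | inj₁ refl               = 0≤u
      ... | inj₂ (inj₁ refl)        = 0≤v
      ... | inj₂ (inj₂ (w≢u , w≢v)) =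
        subst (0# ≤ᵣ_) (sym (shift-transfer-elsewhere s w w≢u w≢v)) (x≥0 w)

    shift-transfer-supp : InSupp R x u → InSupp R x v →
      ∀ s w → InSupp R (shift x (transfer u v) s) w → InSupp R x w
    shift-transfer-supp xu≢0 xv≢0 s w zw≢0 with ≡-or-≡-or-≢ u v w
    ... | inj₁ refl               = xu≢0
    ... | inj₂ (inj₁ refl)        = xv≢0
    ... | inj₂ (inj₂ (w≢u , w≢v)) =
      λ xw≡0 → zw≢0 (trans (shift-transfer-elsewhere s w w≢u w≢v) xw≡0)

  IsMinimizerOf : ∀ {n} → ((Fin n → Carrier) → Carrier) → (Fin n → Carrier) → Set
  IsMinimizerOf F x = InSimplex R x × (∀ y → InSimplex R y → F x ≤ᵣ F y)

  affine-transfer⇒smaller-support : ∀ {n} (F : (Fin n → Carrier) → Carrier) →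
    (∀ {y y′} → (∀ w → y w ≡ y′ w) → F y ≡ F y′) →
    ∀ {x u v} → u ≢ v → IsMinimizerOf F x → InSupp R x u → InSupp R x v →
    Affine (λ s → F (shift x (transfer u v) s)) →
    ∃ λ x′ → IsMinimizerOf F x′ × SuppStrictSub R x′ x
  affine-transfer⇒smaller-support {n} F F-cong {x} {u} {v} u≢v (x∈Δ , x-min) xu≢0 xv≢0 affine =
    Sum.[ (λ ≤F0 → endpoint (x u) (≡0⇒0≤ u-emptied) (≡x+y⇒0≤ v-filled 0≤xv 0≤xu)
                             ≤F0 u xu≢0 u-emptied)
        , (λ ≤F0 → endpoint (- x v) (≡x+y⇒0≤ u-filled 0≤xu 0≤xv) (≡0⇒0≤ v-emptied)
                             ≤F0 v xv≢0 v-emptied)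
        ] (affine-≤-endpoint affine (0≤x⇒-x≤0 0≤xv) 0≤xu)
    where
    z : Carrier → Fin n → Carrier
    z = shift x (transfer u v)

    0≤xu : 0# ≤ᵣ x u
    0≤xu = proj₁ x∈Δ u

    0≤xv : 0# ≤ᵣ x v
    0≤xv = proj₁ x∈Δ v

    u-emptied : z (x u) u ≡ 0#
    u-emptied = trans (shift-transfer-source x u≢v (x u)) (+-inverse (x u))

    v-filled : z (x u) v ≡ x v + x u
    v-filled = shift-transfer-target x u≢v (x u)

    v-emptied : z (- x v) v ≡ 0#
    v-emptied = trans (shift-transfer-target x u≢v (- x v)) (+-inverse (x v))

    u-filled : z (- x v) u ≡ x u + x v
    u-filled = trans (shift-transfer-source x u≢v (- x v)) (cong (x u +_) (-‿involutive (x v)))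

    ≡0⇒0≤ : ∀ {c} → c ≡ 0# → 0# ≤ᵣ c
    ≡0⇒0≤ c≡0 = subst (0# ≤ᵣ_) (sym c≡0) (≤-refl 0#)

    ≡x+y⇒0≤ : ∀ {c a b} → c ≡ a + b → 0# ≤ᵣ a → 0# ≤ᵣ b → 0# ≤ᵣ c
    ≡x+y⇒0≤ c≡a+b 0≤a 0≤b = subst (0# ≤ᵣ_) (sym c≡a+b) (0≤x⇒0≤y⇒0≤x+y 0≤a 0≤b)

    endpoint : ∀ s → 0# ≤ᵣ z s u → 0# ≤ᵣ z s v → F (z s) ≤ᵣ F (z 0#) →
               ∀ a → InSupp R x a → z s a ≡ 0# →
               ∃ λ x′ → IsMinimizerOf F x′ × SuppStrictSub R x′ x
    endpoint s 0≤u 0≤v ≤F0 a xa≢0 za≡0 =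
      z s , (shift-transfer-InSimplex x u≢v x∈Δ s 0≤u 0≤v ,
             λ y y∈Δ → ≤-trans (subst (F (z s) ≤ᵣ_) (F-cong shift-zero) ≤F0) (x-min y y∈Δ))
          , shift-transfer-supp x u≢v xu≢0 xv≢0 s , a , xa≢0 , za≡0

  module _ {n} (G : SimpleGraph n) (t : ℕ) where

    Φ-cong : ∀ {y y′} → (∀ w → y w ≡ y′ w) → Φ R G t y ≡ Φ R G t y′
    Φ-cong y≗y′ = cong₂ (λ a b → a + - b)
      (cong (sumR R) (map-cong (λ w → cong (λ c → c * _ * _) (y≗y′ w)) (allFin n)))
      (cong (sumR R) (map-cong (λ S → cong (prodR R) (map-cong y≗y′ (vertices S)))
                               (copiesK G t)))

    Φ-affine-along-non-edge : ∀ {u v} → u ≢ v → Adj G u v ≡ false →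
                              ∀ x d → (∀ w → w ≢ u → w ≢ v → d w ≡ 0#) →
                              Affine (λ s → Φ R G t (shift x d s))
    Φ-affine-along-non-edge u≢v non-edge x d d-supp =
      affine-+ (affine-sum _ (allFin n) (All.tabulate λ {w} _ → weighted w _ _))
               (affine-neg (affine-sum _ (copiesK G t) (All.tabulate copy-affine)))
      where
      weighted : ∀ w a b → Affine (λ s → shift x d s w * a * b)
      weighted w a b = affine-*ʳ (affine-*ʳ (affine-shift x d w) a) b

      copy-affine : ∀ {S} → S ∈ copiesK G t →
                    Affine (λ s → prodR R (map (shift x d s) (vertices S)))
      copy-affine {S} S∈K with clique-misses-non-edge G S non-edge u≢v (copiesK-clique G S∈K)
      ... | inj₁ Su≡false =
        affine-prod (vertices S) (vertices-unique S) (fixed-or-≡ d-supp (vertices-avoid S Su≡false))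
      ... | inj₂ Sv≡false =
        affine-prod (vertices S) (vertices-unique S)
                    (fixed-or-≡ (λ w w≢v w≢u → d-supp w w≢u w≢v) (vertices-avoid S Sv≡false))

corollary3 : (R : RealField) (n : ℕ) (G : SimpleGraph n) (t : ℕ) → 2 ≤ t →
    (x : Fin n → RealField.Carrier R) →
    IsMinSuppMinimizer R G t x → SuppIsClique R G x
corollary3 R n G t _ x (x-min , no-smaller) u v u≢v xu≢0 xv≢0 with Adj G u v in adj
... | true  = refl
... | false = ⊥-elim (no-smaller
  (affine-transfer⇒smaller-support R (Φ R G t) (Φ-cong R G t) u≢v x-min xu≢0 xv≢0
    (Φ-affine-along-non-edge R G t u≢v adj x (transfer R u v) (transfer-elsewhere R u v))))
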